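{- Let $A\subseteq(0,\infty)$ be contained in a geometric progression $\{r^nx\}_{n\in\mathbb{Z}}$ with $x>0$ and common ratio $r\in\mathbb{Q}$, $r>1$. Then $A$ is a Sidon set. In particular, if $|A|=k$, then $|A+A|=(k^2+k)/2$.
   Context: $A+A=\{a+b: a,b\in A\}$. A Sidon set is a set $A$ such that whenever $a+b=c+d$ with $a,b,c,d\in A$, the pair $\{a,b\}$ equals the pair $\{c,d\}$ (no repeated sums other than those from commutativity). -}

module Defs where

open import Level using (Level; _⊔_)
open import Data.Nat using (ℕ; zero; suc)
open import Data.Integer using (ℤ; +_; -[1+_])
open import Data.Rational using (ℚ; 0ℚ; 1ℚ; _<_; 1/_; NonZero; positive)
  renaming (_*_ to _*ℚ_)
open import Data.Rational.Properties using (pos⇒nonZero; <-trans)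
open import Data.Product using (Σ; ∃; _×_; _,_)
open import Data.Sum using (_⊎_)
open import Data.List using (List; length)
open import Data.List.Relation.Unary.All using (All)
open import Relation.Binary.PropositionalEquality using (_≡_)
open import Algebra.Bundles using (CommutativeRing)
import Data.List.Membership.Setoid as SetoidMembership
import Data.List.Relation.Unary.Unique.Setoid as SetoidUnique

powℕ : ℚ → ℕ → ℚ
powℕ r zero    = 1ℚ
powℕ r (suc n) = r *ℚ powℕ r n

powℤ : (r : ℚ) → .{{NonZero r}} → ℤ → ℚ
powℤ r (+ n)    = powℕ r n
powℤ r -[1+ n ] = powℕ (1/ r) (suc n)

>1⇒nonZero : (r : ℚ) → 1ℚ < r → NonZero r
>1⇒nonZero r 1<r = pos⇒nonZero r {{positive (<-trans 0<1 1<r)}}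
  where
  open import Data.Rational using (*<*)
  open import Data.Integer using (+<+)
  open import Data.Nat using (s≤s; z≤n)
  0<1 : 0ℚ < 1ℚ
  0<1 = *<* (+<+ (s≤s z≤n))

module _ {c ℓ : Level} (R : CommutativeRing c ℓ) where
  open CommutativeRing R
  open SetoidMembership setoid using (_∈_)
  open SetoidUnique setoid using (Unique)

  -- x is cancellable for multiplication (holds for x ≠ 0 in a field, e.g. x > 0 in ℝ)
  Cancellable : Carrier → Set (c ⊔ ℓ)
  Cancellable x = ∀ y z → x * y ≈ x * z → y ≈ z

  -- a lies in the geometric progression { r^n x : n ∈ ℤ }, where ι : ℚ → R embeds ℚ
  InGeomProg : (ι : ℚ → Carrier) (r : ℚ) → 1ℚ < r → Carrier → Carrier → Set ℓ
  InGeomProg ι r 1<r x a =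
    ∃ λ (n : ℤ) → a ≈ x * ι (powℤ r {{>1⇒nonZero r 1<r}} n)

  IsSidon : {p : Level} → (Carrier → Set p) → Set (c ⊔ ℓ ⊔ p)
  IsSidon A = ∀ a b a' b' → A a → A b → A a' → A b' →
    a + b ≈ a' + b' → (a ≈ a' × b ≈ b') ⊎ (a ≈ b' × b ≈ a')

  Sumset : {p : Level} → (Carrier → Set p) → Carrier → Set (c ⊔ ℓ ⊔ p)
  Sumset A s = ∃ λ a → ∃ λ b → A a × A b × s ≈ a + b

  HasCard : {p : Level} → (Carrier → Set p) → ℕ → Set (c ⊔ ℓ ⊔ p)
  HasCard A k = Σ (List Carrier) λ xs →
    length xs ≡ k × Unique xs × All A xs × (∀ a → A a → a ∈ xs)

-- Write r = P/Q in lowest terms. Multiplying r^i + r^j = r^k + r^l by a common power r^M and then by a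
-- power of Q turns it into an equation P^a Q^a' + P^b Q^b' = P^c Q^c' + P^d Q^d' between monomials of
-- one common degree. While all four exponents of P are positive, divide by P. Once one of them is 0,
-- reduce modulo P: since P is coprime to Q, the term Q^N must be matched by another term free of P,
-- and the remaining two terms coincide because P^a Q^(N-a) is strictly increasing in a.
module Submission where

open import Defs
open import Data.Product using (_×_; _,_; proj₁; proj₂)
import Data.Product as Product
open import Data.Sum using (_⊎_; inj₁; inj₂; [_,_]′)
import Data.Sum as Sum
open import Data.Empty using (⊥-elim)
open import Relation.Nullary using (¬_)
import Relation.Binary.PropositionalEquality as ≡
open ≡ using (_≡_)

SamePair : ∀ {a} {X : Set a} → X → X → X → X → Set a
SamePair x y u v = (x ≡ u × y ≡ v) ⊎ (x ≡ v × y ≡ u)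

module _ {a} {X : Set a} {x y u v : X} where

  samePair-sym : SamePair u v x y → SamePair x y u v
  samePair-sym (inj₁ (≡.refl , ≡.refl)) = inj₁ (≡.refl , ≡.refl)
  samePair-sym (inj₂ (≡.refl , ≡.refl)) = inj₂ (≡.refl , ≡.refl)

  samePair-swapˡ : SamePair y x u v → SamePair x y u v
  samePair-swapˡ (inj₁ (≡.refl , ≡.refl)) = inj₂ (≡.refl , ≡.refl)
  samePair-swapˡ (inj₂ (≡.refl , ≡.refl)) = inj₁ (≡.refl , ≡.refl)

  samePair-map : ∀ {b} {Y : Set b} (f : X → Y) → SamePair x y u v → SamePair (f x) (f y) (f u) (f v)
  samePair-map f = Sum.map (Product.map (≡.cong f) (≡.cong f)) (Product.map (≡.cong f) (≡.cong f))

open import Data.Nat.Base using (ℕ; NonZero)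
import Data.Nat.Base as ℕ
open import Data.Nat.Coprimality using (Coprime)

module HomogeneousMonomials {P Q : ℕ} (Q<P : Q ℕ.< P) .{{_ : NonZero Q}} (P⊥Q : Coprime P Q) where

  open import Data.Nat
  open import Data.Nat.Properties
  open import Data.Nat.Divisibility
  open import Data.Nat.Coprimality using (coprime-divisor)
  open import Relation.Binary.Definitions using (tri<; tri≈; tri>)
  open ≡

  instance
    P≢0 : NonZero P
    P≢0 = >-nonZero (<-≤-trans (>-nonZero⁻¹ Q) (<⇒≤ Q<P))

  monomial : ℕ → ℕ → ℕ
  monomial i j = P ^ i * Q ^ j

  monomial-suc : ∀ i j → monomial (suc i) j ≡ P * monomial i j
  monomial-suc i j = *-assoc P (P ^ i) (Q ^ j)

  monomial-< : ∀ i j k l → i < k → i + j ≡ k + l → monomial i j < monomial k l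
  monomial-< i j k l i<k deg with m≤n⇒∃[o]m+o≡n i<k
  ... | e , refl = begin-strict
    P ^ i * Q ^ j                  ≡⟨ cong (λ n → P ^ i * Q ^ n) j≡1+e+l ⟩
    P ^ i * Q ^ (suc e + l)        ≡⟨ cong (P ^ i *_) (^-distribˡ-+-* Q (suc e) l) ⟩
    P ^ i * (Q ^ suc e * Q ^ l)    <⟨ *-monoʳ-< (P ^ i) {{m^n≢0 P i}}
                                        (*-monoˡ-< (Q ^ l) {{m^n≢0 Q l}} (^-monoˡ-< (suc e) Q<P)) ⟩
    P ^ i * (P ^ suc e * Q ^ l)    ≡⟨ sym (*-assoc (P ^ i) (P ^ suc e) (Q ^ l)) ⟩
    P ^ i * P ^ suc e * Q ^ l      ≡⟨ cong (_* Q ^ l) (sym (^-distribˡ-+-* P i (suc e))) ⟩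
    P ^ (i + suc e) * Q ^ l        ≡⟨ cong (λ n → P ^ n * Q ^ l) (+-suc i e) ⟩
    P ^ (suc i + e) * Q ^ l        ∎
    where
    open ≤-Reasoning
    j≡1+e+l : j ≡ suc e + l
    j≡1+e+l = +-cancelˡ-≡ i j (suc e + l)
      (trans deg (trans (cong (_+ l) (sym (+-suc i e))) (+-assoc i (suc e) l)))

  monomial-injective : ∀ i j k l → i + j ≡ k + l → monomial i j ≡ monomial k l → i ≡ k
  monomial-injective i j k l deg eq with <-cmp i k
  ... | tri< i<k _ _ = ⊥-elim (<-irrefl eq (monomial-< i j k l i<k deg))
  ... | tri≈ _ i≡k _ = i≡k
  ... | tri> _ _ k<i = ⊥-elim (<-irrefl (sym eq) (monomial-< k l i j k<i (sym deg)))

  P∤Q^ : ∀ n → ¬ P ∣ Q ^ n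
  P∤Q^ zero    P∣1    = <-irrefl (sym (∣1⇒≡1 P∣1)) (<-≤-trans (s≤s (>-nonZero⁻¹ Q)) Q<P)
  P∤Q^ (suc n) P∣Qⁿ⁺¹ = P∤Q^ n (coprime-divisor P⊥Q P∣Qⁿ⁺¹)

  P∣monomial-suc : ∀ i j → P ∣ monomial (suc i) j
  P∣monomial-suc i j = subst (P ∣_) (sym (monomial-suc i j)) (m∣m*n (monomial i j))

  -- P divides every term of positive P-degree, and two terms of P-degree 0 are smaller than any
  -- two terms of positive P-degree.
  monomial-sidon₀ : ∀ {N} a' b b' c c' d d' → a' ≡ N → b + b' ≡ N → c + c' ≡ N → d + d' ≡ N →
    monomial 0 a' + monomial b b' ≡ monomial c c' + monomial d d' → SamePair 0 b c d
  monomial-sidon₀ a' b b' zero c' d d' refl hb refl hd eq =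
    inj₁ (refl , monomial-injective b b' d d' (trans hb (sym hd)) (+-cancelˡ-≡ (monomial 0 a') _ _ eq))
  monomial-sidon₀ a' b b' (suc c) c' zero d' refl hb hc refl eq =
    inj₂ (refl , monomial-injective b b' (suc c) c' (trans hb (sym hc))
      (+-cancelˡ-≡ (monomial 0 a') _ _ (trans eq (+-comm (monomial (suc c) c') (monomial 0 a')))))
  monomial-sidon₀ a' zero b' (suc c) c' (suc d) d' refl refl hc hd eq =
    ⊥-elim (<-irrefl eq (+-mono-< (monomial-< 0 a' (suc c) c' z<s (sym hc))
                                  (monomial-< 0 a' (suc d) d' z<s (sym hd))))
  monomial-sidon₀ a' (suc b) b' (suc c) c' (suc d) d' _ _ _ _ eq =
    ⊥-elim (P∤Q^ a' (subst (P ∣_) (*-identityˡ (Q ^ a')) (∣m+n∣m⇒∣n P∣sum (P∣monomial-suc b b'))))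
    where
    P∣sum : P ∣ monomial (suc b) b' + monomial 0 a'
    P∣sum = subst (P ∣_) (trans (sym eq) (+-comm (monomial 0 a') _))
      (∣m∣n⇒∣m+n (P∣monomial-suc c c') (P∣monomial-suc d d'))

  monomial-sidon : ∀ {N} a a' b b' c c' d d' → a + a' ≡ N → b + b' ≡ N → c + c' ≡ N → d + d' ≡ N →
    monomial a a' + monomial b b' ≡ monomial c c' + monomial d d' → SamePair a b c d
  monomial-sidon zero a' b b' c c' d d' ha hb hc hd eq = monomial-sidon₀ a' b b' c c' d d' ha hb hc hd eq
  monomial-sidon (suc a) a' zero b' c c' d d' ha hb hc hd eq =
    samePair-swapˡ (monomial-sidon₀ b' (suc a) a' c c' d d' hb ha hc hd (trans (+-comm (monomial 0 b') _) eq))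
  monomial-sidon (suc a) a' (suc b) b' zero c' d d' ha hb hc hd eq =
    samePair-sym (monomial-sidon₀ c' d d' (suc a) a' (suc b) b' hc hd ha hb (sym eq))
  monomial-sidon (suc a) a' (suc b) b' (suc c) c' zero d' ha hb hc hd eq =
    samePair-sym (samePair-swapˡ (monomial-sidon₀ d' (suc c) c' (suc a) a' (suc b) b' hd hc ha hb
      (trans (+-comm (monomial 0 d') _) (sym eq))))
  monomial-sidon (suc a) a' (suc b) b' (suc c) c' (suc d) d' refl hb hc hd eq =
    samePair-map suc (monomial-sidon a a' b b' c c' d d'
      refl (suc-injective hb) (suc-injective hc) (suc-injective hd)
      (*-cancelˡ-≡ _ _ P (trans (sym (monomial-suc-+ a a' b b')) (trans eq (monomial-suc-+ c c' d d')))))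
    where
    monomial-suc-+ : ∀ x x' y y' →
      monomial (suc x) x' + monomial (suc y) y' ≡ P * (monomial x x' + monomial y y')
    monomial-suc-+ x x' y y' =
      trans (cong₂ _+_ (monomial-suc x x') (monomial-suc y y')) (sym (*-distribˡ-+ P _ _))

module RationalPowers where

  open import Data.Nat.Base using (_^_)
  import Data.Nat.Properties as ℕ
  open import Data.Nat.Coprimality using (coprime?)
  open import Data.Integer as ℤ using (ℤ; +_; -[1+_]; ∣_∣)
  import Data.Integer.Properties as ℤ
  open import Data.Rational as ℚ using (ℚ; mkℚ; 1ℚ; 1/_; _+_; _*_; _<_; *<*; ↥_; toℚᵘ)
  open import Data.Rational.Properties
  open import Data.Rational.Literals using (fromℤ)
  open import Data.Rational.Unnormalised using (*≡*)
  import Data.Rational.Unnormalised.Properties as ℚᵘ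
  open import Data.Product using (∃-syntax)
  open import Relation.Nullary.Decidable using (recompute)
  open import Algebra.Bundles using (CommutativeMonoid; AbelianGroup)
  open import Algebra.Properties.CommutativeSemigroup (CommutativeMonoid.commutativeSemigroup *-1-commutativeMonoid)
    using (interchange)
  open import Algebra.Properties.CommutativeSemigroup ℕ.+-commutativeSemigroup using (x∙yz≈y∙xz)
  open import Algebra.Properties.Group (AbelianGroup.group ℤ.+-0-abelianGroup) using (∙-cancelʳ)
  open ≡

  -- fromℤ builds the normal form directly, so toℚᵘ (fromℕ n) computes to mkℚᵘ (+ n) 0.
  fromℕ : ℕ → ℚ
  fromℕ n = fromℤ (+ n)

  fromℕ-injective : ∀ {m n} → fromℕ m ≡ fromℕ n → m ≡ n
  fromℕ-injective eq = ℤ.+-injective (cong ↥_ eq)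

  fromℕ-+ : ∀ m n → fromℕ (m ℕ.+ n) ≡ fromℕ m + fromℕ n
  fromℕ-+ m n = toℚᵘ-injective (ℚᵘ.≃-trans
    (*≡* (cong (ℤ._* + 1) (trans (ℤ.pos-+ m n)
      (sym (cong₂ ℤ._+_ (ℤ.*-identityʳ (+ m)) (ℤ.*-identityʳ (+ n)))))))
    (ℚᵘ.≃-sym (toℚᵘ-homo-+ (fromℕ m) (fromℕ n))))

  fromℕ-* : ∀ m n → fromℕ (m ℕ.* n) ≡ fromℕ m * fromℕ n
  fromℕ-* m n = toℚᵘ-injective (ℚᵘ.≃-trans (*≡* (cong (ℤ._* + 1) (ℤ.pos-* m n)))
    (ℚᵘ.≃-sym (toℚᵘ-homo-* (fromℕ m) (fromℕ n))))

  powℕ-+ : ∀ r m n → powℕ r (m ℕ.+ n) ≡ powℕ r m * powℕ r n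
  powℕ-+ r ℕ.zero    n = sym (*-identityˡ (powℕ r n))
  powℕ-+ r (ℕ.suc m) n = trans (cong (r *_) (powℕ-+ r m n)) (sym (*-assoc r (powℕ r m) (powℕ r n)))

  powℕ-distrib-* : ∀ p q n → powℕ p n * powℕ q n ≡ powℕ (p * q) n
  powℕ-distrib-* p q ℕ.zero    = refl
  powℕ-distrib-* p q (ℕ.suc n) =
    trans (interchange p (powℕ p n) q (powℕ q n)) (cong (p * q *_) (powℕ-distrib-* p q n))

  powℕ-1 : ∀ n → powℕ 1ℚ n ≡ 1ℚ
  powℕ-1 ℕ.zero    = refl
  powℕ-1 (ℕ.suc n) = trans (*-identityˡ (powℕ 1ℚ n)) (powℕ-1 n)

  module Fraction (P d : ℕ) (P⊥Q : Coprime P (ℕ.suc d)) (Q<P : ℕ.suc d ℕ.< P) where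

    Q : ℕ
    Q = ℕ.suc d

    r : ℚ
    r = mkℚ (+ P) d P⊥Q

    open HomogeneousMonomials Q<P P⊥Q

    r*Q≡P : r * fromℕ Q ≡ fromℕ P
    r*Q≡P = toℚᵘ-injective (ℚᵘ.≃-trans (toℚᵘ-homo-* r (fromℕ Q))
      (*≡* (trans (ℤ.*-identityʳ (+ P ℤ.* + Q)) (cong (λ n → + P ℤ.* + n) (sym (ℕ.*-identityʳ Q))))))

    rⁿ*Qⁿ≡Pⁿ : ∀ n → powℕ r n * fromℕ (Q ^ n) ≡ fromℕ (P ^ n)
    rⁿ*Qⁿ≡Pⁿ ℕ.zero    = refl
    rⁿ*Qⁿ≡Pⁿ (ℕ.suc n) = begin
      r * powℕ r n * fromℕ (Q ℕ.* Q ^ n)          ≡⟨ cong (r * powℕ r n *_) (fromℕ-* Q (Q ^ n)) ⟩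
      r * powℕ r n * (fromℕ Q * fromℕ (Q ^ n))    ≡⟨ interchange r (powℕ r n) (fromℕ Q) _ ⟩
      r * fromℕ Q * (powℕ r n * fromℕ (Q ^ n))    ≡⟨ cong₂ _*_ r*Q≡P (rⁿ*Qⁿ≡Pⁿ n) ⟩
      fromℕ P * fromℕ (P ^ n)                     ≡⟨ sym (fromℕ-* P (P ^ n)) ⟩
      fromℕ (P ℕ.* P ^ n)                         ∎
      where open ≡-Reasoning

    rⁿ*Qⁿ⁺ᵐ≡monomial : ∀ n m → powℕ r n * fromℕ (Q ^ (n ℕ.+ m)) ≡ fromℕ (monomial n m)
    rⁿ*Qⁿ⁺ᵐ≡monomial n m = begin
      powℕ r n * fromℕ (Q ^ (n ℕ.+ m))              ≡⟨ cong (powℕ r n *_) (cong fromℕ (ℕ.^-distribˡ-+-* Q n m)) ⟩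
      powℕ r n * fromℕ (Q ^ n ℕ.* Q ^ m)            ≡⟨ cong (powℕ r n *_) (fromℕ-* (Q ^ n) (Q ^ m)) ⟩
      powℕ r n * (fromℕ (Q ^ n) * fromℕ (Q ^ m))    ≡⟨ sym (*-assoc (powℕ r n) _ _) ⟩
      powℕ r n * fromℕ (Q ^ n) * fromℕ (Q ^ m)      ≡⟨ cong (_* fromℕ (Q ^ m)) (rⁿ*Qⁿ≡Pⁿ n) ⟩
      fromℕ (P ^ n) * fromℕ (Q ^ m)                 ≡⟨ sym (fromℕ-* (P ^ n) (Q ^ m)) ⟩
      fromℕ (monomial n m)                          ∎
      where open ≡-Reasoning

    [rᵃ+rᵇ]*Qᴺ≡monomial-sum : ∀ {N} a a' b b' → a ℕ.+ a' ≡ N → b ℕ.+ b' ≡ N →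
      (powℕ r a + powℕ r b) * fromℕ (Q ^ N) ≡ fromℕ (monomial a a' ℕ.+ monomial b b')
    [rᵃ+rᵇ]*Qᴺ≡monomial-sum a a' b b' refl hb = begin
      (powℕ r a + powℕ r b) * Qᴺ                    ≡⟨ *-distribʳ-+ Qᴺ (powℕ r a) (powℕ r b) ⟩
      powℕ r a * Qᴺ + powℕ r b * Qᴺ
        ≡⟨ cong (λ k → powℕ r a * Qᴺ + powℕ r b * fromℕ (Q ^ k)) (sym hb) ⟩
      powℕ r a * Qᴺ + powℕ r b * fromℕ (Q ^ (b ℕ.+ b'))
        ≡⟨ cong₂ _+_ (rⁿ*Qⁿ⁺ᵐ≡monomial a a') (rⁿ*Qⁿ⁺ᵐ≡monomial b b') ⟩
      fromℕ (monomial a a') + fromℕ (monomial b b') ≡⟨ sym (fromℕ-+ (monomial a a') (monomial b b')) ⟩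
      fromℕ (monomial a a' ℕ.+ monomial b b')       ∎
      where
      open ≡-Reasoning
      Qᴺ = fromℕ (Q ^ (a ℕ.+ a'))

    powℕ-sidon : ∀ a b c e → powℕ r a + powℕ r b ≡ powℕ r c + powℕ r e → SamePair a b c e
    powℕ-sidon a b c e eq = monomial-sidon a a' b b' c c' e e' refl hb hc he (fromℕ-injective (begin
      fromℕ (monomial a a' ℕ.+ monomial b b')   ≡⟨ sym ([rᵃ+rᵇ]*Qᴺ≡monomial-sum a a' b b' refl hb) ⟩
      (powℕ r a + powℕ r b) * fromℕ (Q ^ N)   ≡⟨ cong (_* fromℕ (Q ^ N)) eq ⟩
      (powℕ r c + powℕ r e) * fromℕ (Q ^ N)   ≡⟨ [rᵃ+rᵇ]*Qᴺ≡monomial-sum c c' e e' hc he ⟩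
      fromℕ (monomial c c' ℕ.+ monomial e e')   ∎))
      where
      open ≡-Reasoning
      a' = b ℕ.+ (c ℕ.+ e)
      b' = a ℕ.+ (c ℕ.+ e)
      c' = e ℕ.+ (a ℕ.+ b)
      e' = c ℕ.+ (a ℕ.+ b)
      N = a ℕ.+ a'
      hb : b ℕ.+ b' ≡ N
      hb = x∙yz≈y∙xz b a (c ℕ.+ e)
      hc : c ℕ.+ c' ≡ N
      hc = trans (sym (ℕ.+-assoc c e (a ℕ.+ b)))
             (trans (ℕ.+-comm (c ℕ.+ e) (a ℕ.+ b)) (ℕ.+-assoc a b (c ℕ.+ e)))
      he : e ℕ.+ e' ≡ N
      he = trans (x∙yz≈y∙xz e c (a ℕ.+ b)) hc

  powℕ-sidon : ∀ r → 1ℚ < r → ∀ a b c e →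
    powℕ r a + powℕ r b ≡ powℕ r c + powℕ r e → SamePair a b c e
  powℕ-sidon (mkℚ -[1+ n ] d _) (*<* 1*Q<-n) =
    ⊥-elim (ℤ.+≮- (subst₂ ℤ._<_ (ℤ.*-identityˡ (+ ℕ.suc d)) (ℤ.*-identityʳ -[1+ n ]) 1*Q<-n))
  powℕ-sidon (mkℚ (+ P) d P⊥Q) (*<* 1*Q<P*1) =
    Fraction.powℕ-sidon P d (recompute (coprime? P (ℕ.suc d)) P⊥Q)
      (ℤ.drop‿+<+ (subst₂ ℤ._<_ (ℤ.*-identityˡ (+ ℕ.suc d)) (ℤ.*-identityʳ (+ P)) 1*Q<P*1))

  module _ (r : ℚ) .{{_ : ℚ.NonZero r}} where

    powℤ-*-powℕ : ∀ i M → ∣ i ∣ ℕ.≤ M →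
      ∃[ e ] (+ e ≡ i ℤ.+ + M × powℤ r i * powℕ r M ≡ powℕ r e)
    powℤ-*-powℕ (+ n) M _ = n ℕ.+ M , ℤ.pos-+ n M , sym (powℕ-+ r n M)
    powℤ-*-powℕ -[1+ n ] M n<M with ℕ.m≤n⇒∃[o]m+o≡n n<M
    ... | e , refl = e , e≡-[1+n]+[1+n+e] , (begin
      powℕ (1/ r) (ℕ.suc n) * powℕ r (ℕ.suc n ℕ.+ e)
        ≡⟨ cong (powℕ (1/ r) (ℕ.suc n) *_) (powℕ-+ r (ℕ.suc n) e) ⟩
      powℕ (1/ r) (ℕ.suc n) * (powℕ r (ℕ.suc n) * powℕ r e)
        ≡⟨ sym (*-assoc (powℕ (1/ r) (ℕ.suc n)) _ _) ⟩
      powℕ (1/ r) (ℕ.suc n) * powℕ r (ℕ.suc n) * powℕ r e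
        ≡⟨ cong (_* powℕ r e) (powℕ-distrib-* (1/ r) r (ℕ.suc n)) ⟩
      powℕ (1/ r * r) (ℕ.suc n) * powℕ r e
        ≡⟨ cong (λ s → powℕ s (ℕ.suc n) * powℕ r e) (*-inverseˡ r) ⟩
      powℕ 1ℚ (ℕ.suc n) * powℕ r e            ≡⟨ cong (_* powℕ r e) (powℕ-1 (ℕ.suc n)) ⟩
      1ℚ * powℕ r e                           ≡⟨ *-identityˡ (powℕ r e) ⟩
      powℕ r e                                ∎)
      where
      open ≡-Reasoning
      e≡-[1+n]+[1+n+e] : + e ≡ -[1+ n ] ℤ.+ + (ℕ.suc n ℕ.+ e)
      e≡-[1+n]+[1+n+e] = sym (trans (cong (ℕ.suc n ℕ.+ e ℤ.⊖_) (sym (ℕ.+-identityʳ (ℕ.suc n))))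
                                    (ℤ.+-cancelˡ-⊖ (ℕ.suc n) e 0))

    powℤ-sidon-bounded : 1ℚ < r → ∀ M i j k l →
      ∣ i ∣ ℕ.≤ M → ∣ j ∣ ℕ.≤ M → ∣ k ∣ ℕ.≤ M → ∣ l ∣ ℕ.≤ M →
      powℤ r i + powℤ r j ≡ powℤ r k + powℤ r l → SamePair i j k l
    powℤ-sidon-bounded 1<r M i j k l i≤M j≤M k≤M l≤M eq
      with powℤ-*-powℕ i M i≤M | powℤ-*-powℕ j M j≤M | powℤ-*-powℕ k M k≤M | powℤ-*-powℕ l M l≤M
    ... | e₁ , z₁ , q₁ | e₂ , z₂ , q₂ | e₃ , z₃ , q₃ | e₄ , z₄ , q₄ =
      Sum.map (Product.map (cancel z₁ z₃) (cancel z₂ z₄)) (Product.map (cancel z₁ z₄) (cancel z₂ z₃))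
        (powℕ-sidon r 1<r e₁ e₂ e₃ e₄ (begin
          powℕ r e₁ + powℕ r e₂            ≡⟨ sym (cong₂ _+_ q₁ q₂) ⟩
          powℤ r i * rᴹ + powℤ r j * rᴹ    ≡⟨ sym (*-distribʳ-+ rᴹ (powℤ r i) (powℤ r j)) ⟩
          (powℤ r i + powℤ r j) * rᴹ       ≡⟨ cong (_* rᴹ) eq ⟩
          (powℤ r k + powℤ r l) * rᴹ       ≡⟨ *-distribʳ-+ rᴹ (powℤ r k) (powℤ r l) ⟩
          powℤ r k * rᴹ + powℤ r l * rᴹ    ≡⟨ cong₂ _+_ q₃ q₄ ⟩
          powℕ r e₃ + powℕ r e₄            ∎))
      where
      open ≡-Reasoning
      rᴹ = powℕ r M
      cancel : ∀ {e e' t t'} → + e ≡ t ℤ.+ + M → + e' ≡ t' ℤ.+ + M → e ≡ e' → t ≡ t'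
      cancel {t = t} {t'} z z' refl = ∙-cancelʳ (+ M) t t' (trans (sym z) z')

    powℤ-sidon : 1ℚ < r → ∀ i j k l →
      powℤ r i + powℤ r j ≡ powℤ r k + powℤ r l → SamePair i j k l
    powℤ-sidon 1<r i j k l =
      powℤ-sidon-bounded 1<r (∣ i ∣ ℕ.+ (∣ j ∣ ℕ.+ (∣ k ∣ ℕ.+ ∣ l ∣))) i j k l
      (ℕ.m≤m+n ∣ i ∣ _)
      (ℕ.≤-trans (ℕ.m≤m+n ∣ j ∣ _) (ℕ.m≤n+m _ ∣ i ∣))
      (ℕ.≤-trans (ℕ.m≤m+n ∣ k ∣ _) (ℕ.≤-trans (ℕ.m≤n+m _ ∣ j ∣) (ℕ.m≤n+m _ ∣ i ∣)))
      (ℕ.≤-trans (ℕ.m≤n+m ∣ l ∣ _) (ℕ.≤-trans (ℕ.m≤n+m _ ∣ j ∣) (ℕ.m≤n+m _ ∣ i ∣)))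

open RationalPowers using (powℤ-sidon)

open import Level using (Level)
open import Data.Rational as ℚ using (ℚ; 1ℚ; _<_)
open import Data.Rational.Properties using (+-*-rawRing)
open import Algebra.Bundles using (CommutativeRing)
open import Algebra.Morphism.Structures using (module RingMorphisms)
open import Data.List using (List; []; _∷_; map; _++_; length)
open import Data.List.Relation.Unary.All as All using (All; []; _∷_)
open import Data.List.Relation.Unary.AllPairs using (AllPairs; []; _∷_)

AllPairs-map-All : ∀ {a p r s} {X : Set a} {P : X → Set p} {R : X → X → Set r} {S : X → X → Set s} →
  (∀ {u v} → P u → P v → R u v → S u v) → ∀ {xs} → All P xs → AllPairs R xs → AllPairs S xs
AllPairs-map-All f []         []         = []
AllPairs-map-All f (pu ∷ pus) (Rus ∷ Rs) =
  All.zipWith (λ (pv , Ruv) → f pu pv Ruv) (pus , Rus) ∷ AllPairs-map-All f pus Rs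

module _ {c ℓ} (R : CommutativeRing c ℓ) where

  import Data.Nat.Properties as ℕ
  open import Data.Nat.DivMod using (_/_; m*n/n≡m)
  open import Data.Nat.Tactic.RingSolver using (solve-∀)
  open import Data.List.Properties using (length-++; length-map)
  import Data.List.Relation.Unary.All.Properties as All
  open import Data.List.Relation.Unary.Any as Any using (here; there)
  import Data.List.Relation.Unary.Any.Properties as Any
  import Data.List.Relation.Unary.AllPairs.Properties as AllPairs
  open CommutativeRing R
  open import Data.List.Membership.Setoid setoid using (_∈_)
  open import Data.List.Membership.Setoid.Properties using (∈-resp-≈)
  open import Data.List.Relation.Unary.Unique.Setoid setoid using (Unique)

  pairSums : List Carrier → List Carrier
  pairSums []       = []
  pairSums (y ∷ ys) = map (y +_) (y ∷ ys) ++ pairSums ys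

  length-pairSums : ∀ xs → length (pairSums xs) ℕ.* 2 ≡ length xs ℕ.* length xs ℕ.+ length xs
  length-pairSums []       = ≡.refl
  length-pairSums (y ∷ ys) = begin
    length (map (y +_) (y ∷ ys) ++ pairSums ys) ℕ.* 2
      ≡⟨ ≡.cong (ℕ._* 2) (≡.trans (length-++ (map (y +_) (y ∷ ys)))
                                  (≡.cong (ℕ._+ L) (length-map (y +_) (y ∷ ys)))) ⟩
    (ℕ.suc n ℕ.+ L) ℕ.* 2                ≡⟨ ℕ.*-distribʳ-+ 2 (ℕ.suc n) L ⟩
    ℕ.suc n ℕ.* 2 ℕ.+ L ℕ.* 2            ≡⟨ ≡.cong (ℕ.suc n ℕ.* 2 ℕ.+_) (length-pairSums ys) ⟩
    ℕ.suc n ℕ.* 2 ℕ.+ (n ℕ.* n ℕ.+ n)    ≡⟨ triangle n ⟩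
    ℕ.suc n ℕ.* ℕ.suc n ℕ.+ ℕ.suc n      ∎
    where
    open ≡.≡-Reasoning
    n = length ys
    L = length (pairSums ys)
    triangle : ∀ n → ℕ.suc n ℕ.* 2 ℕ.+ (n ℕ.* n ℕ.+ n) ≡ ℕ.suc n ℕ.* ℕ.suc n ℕ.+ ℕ.suc n
    triangle = solve-∀

  All-pairSums : ∀ {p q} {P : Carrier → Set p} {Q : Carrier → Set q} →
    (∀ {u v} → P u → P v → Q (u + v)) → ∀ {xs} → All P xs → All Q (pairSums xs)
  All-pairSums f []         = []
  All-pairSums f (pu ∷ pus) = All.++⁺ (All.map⁺ (All.map (f pu) (pu ∷ pus))) (All-pairSums f pus)

  +-∈-map : ∀ {a b y zs} → a ≈ y → b ∈ zs → a + b ∈ map (y +_) zs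
  +-∈-map a≈y b∈zs = Any.map⁺ (Any.map (+-cong a≈y) b∈zs)

  ∈-pairSums : ∀ {a b} xs → a ∈ xs → b ∈ xs → a + b ∈ pairSums xs
  ∈-pairSums (y ∷ ys) (here a≈y) b∈ = Any.++⁺ˡ (+-∈-map a≈y b∈)
  ∈-pairSums {a} {b} (y ∷ ys) (there a∈) (here b≈y) =
    Any.++⁺ˡ (∈-resp-≈ setoid (+-comm b a) (+-∈-map b≈y (there a∈)))
  ∈-pairSums (y ∷ ys) (there a∈) (there b∈) = Any.++⁺ʳ (map (y +_) (y ∷ ys)) (∈-pairSums ys a∈ b∈)

  module _ {p} {A : Carrier → Set p} (sidon : IsSidon R A) where

    sidon-cancelˡ : ∀ {y u v} → A y → A u → A v → y + u ≈ y + v → u ≈ v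
    sidon-cancelˡ Ay Au Av e =
      [ proj₂ , (λ (y≈v , u≈y) → trans u≈y y≈v) ]′ (sidon _ _ _ _ Ay Au Ay Av e)

    sidon-≉ : ∀ {y u w v} → A y → A u → A w → A v → ¬ y ≈ w → ¬ y ≈ v → ¬ y + u ≈ w + v
    sidon-≉ Ay Au Aw Av y≉w y≉v e =
      [ (λ q → y≉w (proj₁ q)) , (λ q → y≉v (proj₁ q)) ]′ (sidon _ _ _ _ Ay Au Aw Av e)

    pairSums-unique : ∀ {xs} → All A xs → Unique xs → Unique (pairSums xs)
    pairSums-unique []        []                 = []
    pairSums-unique {y ∷ ys} (Ay ∷ As) (y∉ys ∷ ys-unique) =
      AllPairs.++⁺ sums-with-y-unique (pairSums-unique As ys-unique) sums-with-y-new
      where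
      sums-with-y-unique : Unique (map (y +_) (y ∷ ys))
      sums-with-y-unique = AllPairs.map⁺
        (AllPairs-map-All (λ Au Av u≉v e → u≉v (sidon-cancelˡ Ay Au Av e)) (Ay ∷ As) (y∉ys ∷ ys-unique))

      sums-with-y-new : All (λ s → All (λ t → ¬ s ≈ t) (pairSums ys)) (map (y +_) (y ∷ ys))
      sums-with-y-new = All.map⁺ (All.map
        (λ Au → All-pairSums (λ (Aw , y≉w) (Av , y≉v) → sidon-≉ Ay Au Aw Av y≉w y≉v) (All.zip (As , y∉ys)))
        (Ay ∷ As))

    sidon⇒HasCard-Sumset : ∀ k → HasCard R A k → HasCard R (Sumset R A) ((k ℕ.* k ℕ.+ k) / 2)
    sidon⇒HasCard-Sumset k (xs , ≡.refl , xs-unique , As , complete) =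
      pairSums xs ,
      ≡.sym (≡.trans (≡.cong (_/ 2) (≡.sym (length-pairSums xs))) (m*n/n≡m (length (pairSums xs)) 2)) ,
      pairSums-unique As xs-unique ,
      All-pairSums (λ {u} {v} Au Av → u , v , Au , Av , refl) As ,
      λ { s (a , b , Aa , Ab , s≈a+b) →
            ∈-resp-≈ setoid (sym s≈a+b) (∈-pairSums xs (complete a Aa) (complete b Ab)) }

  module _ (ι : ℚ → Carrier) (ι-mono : RingMorphisms.IsRingMonomorphism +-*-rawRing rawRing ι)
           (x : Carrier) (x-cancel : Cancellable R x) where

    open RingMorphisms.IsRingMonomorphism ι-mono using (injective; +-homo)
    open import Relation.Binary.Reasoning.Setoid setoid

    x*ι-sum-injective : ∀ p q p' q' → x * ι p + x * ι q ≈ x * ι p' + x * ι q' → p ℚ.+ q ≡ p' ℚ.+ q'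
    x*ι-sum-injective p q p' q' eq = injective (x-cancel _ _ (begin
      x * ι (p ℚ.+ q)        ≈⟨ *-congˡ (+-homo p q) ⟩
      x * (ι p + ι q)        ≈⟨ distribˡ x (ι p) (ι q) ⟩
      x * ι p + x * ι q      ≈⟨ eq ⟩
      x * ι p' + x * ι q'    ≈⟨ distribˡ x (ι p') (ι q') ⟨
      x * (ι p' + ι q')      ≈⟨ *-congˡ (+-homo p' q') ⟨
      x * ι (p' ℚ.+ q')      ∎))

    geomProg-sidon : ∀ {p} r (1<r : 1ℚ < r) (A : Carrier → Set p) →
      (∀ a → A a → InGeomProg R ι r 1<r x a) → IsSidon R A
    geomProg-sidon r 1<r A inGP a b a' b' Aa Ab Aa' Ab' a+b≈a'+b'
      with inGP a Aa | inGP b Ab | inGP a' Aa' | inGP b' Ab'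
    ... | i , a≈ | j , b≈ | k , a'≈ | l , b'≈
      with powℤ-sidon r {{>1⇒nonZero r 1<r}} 1<r i j k l (x*ι-sum-injective _ _ _ _ (begin
        x * ι (rⁱ i) + x * ι (rⁱ j)    ≈⟨ +-cong a≈ b≈ ⟨
        a + b                          ≈⟨ a+b≈a'+b' ⟩
        a' + b'                        ≈⟨ +-cong a'≈ b'≈ ⟩
        x * ι (rⁱ k) + x * ι (rⁱ l)    ∎))
      where rⁱ = powℤ r {{>1⇒nonZero r 1<r}}
    ... | inj₁ (≡.refl , ≡.refl) = inj₁ (trans a≈ (sym a'≈) , trans b≈ (sym b'≈))
    ... | inj₂ (≡.refl , ≡.refl) = inj₂ (trans a≈ (sym b'≈) , trans b≈ (sym a'≈))

open import Data.Nat using (ℕ; _+_; _*_; _/_)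

lemma2p4 : ∀ {c ℓ p : Level} (R : CommutativeRing c ℓ)
    (ι : ℚ → CommutativeRing.Carrier R) →
    RingMorphisms.IsRingMonomorphism +-*-rawRing (CommutativeRing.rawRing R) ι →
    (x : CommutativeRing.Carrier R) → Cancellable R x →
    (r : ℚ) (1<r : 1ℚ < r) →
    (A : CommutativeRing.Carrier R → Set p) →
    (∀ a → A a → InGeomProg R ι r 1<r x a) →
    IsSidon R A × (∀ k → HasCard R A k → HasCard R (Sumset R A) ((k * k + k) / 2))
lemma2p4 R ι ι-mono x x-cancel r 1<r A inGP = sidon , sidon⇒HasCard-Sumset R sidon
  where
  sidon : IsSidon R A
  sidon = geomProg-sidon R ι ι-mono x x-cancel r 1<r A inGP
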